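{- Let $G$ be an odd wheel consisting of the cycle $v_1v_2\dots v_kv_1$ ($k>3$, $k$ odd) and an inner vertex $v$ adjacent to all $v_i$, with principal path $\overrightarrow{v_kv_1v_2}$, and let $e$ be any edge of $G$ incident to $v$. Then $P(G-\overrightarrow{v_kv_1v_2}-e)$ contains a non-vanishing monomial $\eta\,v_1^0v_2^0v_k^0v^{\alpha}\prod_{i=3}^{k-1}v_i^{\alpha_i}$ with $\alpha_i\le2$ and $\alpha\le4$.
   Context: For a graph $G$, vertices are also variables and $P(G)=\prod_{xy\in E(G),\,x<y}(x-y)$ for a fixed arbitrary orientation; a monomial is non-vanishing if its coefficient is nonzero. $G-\overrightarrow{v_kv_1v_2}-e$ is $G$ with edges $v_kv_1$, $v_1v_2$ and $e$ deleted (vertices kept). -}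

module Defs where

open import Data.Bool using (Bool; true; false; _∧_; _∨_; if_then_else_)
open import Data.Nat using (ℕ; zero; suc; _≡ᵇ_; _<ᵇ_; _≤ᵇ_)
open import Data.Fin using (Fin; toℕ; _≟_)
open import Data.List using (List; []; _∷_; concatMap; filter; allFin)
open import Data.Product using (_×_; _,_)
open import Data.Integer using (ℤ; _-_; 0ℤ; 1ℤ)
open import Relation.Nullary using (does)

-- Graphs on vertex set Fin n, given by a list of oriented edges (x , y),
-- standing for the factor (x - y) of the graph polynomial.

Edge : ℕ → Set
Edge n = Fin n × Fin n

Monomial : ℕ → Set
Monomial n = Fin n → ℕ

allZero : ∀ {n} → Monomial n → Bool
allZero {zero}  α = true
allZero {suc n} α = (α Fin.zero ≡ᵇ 0) ∧ allZero (λ i → α (Fin.suc i))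

set : ∀ {n} → Monomial n → Fin n → ℕ → Monomial n
set α z m w = if does (w ≟ z) then m else α w

-- coeff es α = coefficient of the monomial α in ∏_{(x,y) ∈ es} (x - y).
-- (Expansion of the product: [α] ((x - y) · Q) = [α - e_x] Q - [α - e_y] Q.)
coeff : ∀ {n} → List (Edge n) → Monomial n → ℤ
coeff [] α = if allZero α then 1ℤ else 0ℤ
coeff ((x , y) ∷ es) α = dec x - dec y
  where
  dec : _ → ℤ
  dec z with α z
  ... | zero  = 0ℤ
  ... | suc m = coeff es (set α z m)

-- The wheel W_k on vertex set Fin (suc k): vertex 0 is the inner vertex v,
-- vertex i (1 ≤ i ≤ k) is the cycle vertex v_i.

isWheelEdge : ℕ → ℕ → ℕ → Bool
isWheelEdge k a b =
  (a <ᵇ b) ∧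
  (  (a ≡ᵇ 0)
  ∨ ((1 ≤ᵇ a) ∧ (b ≡ᵇ suc a))
  ∨ ((a ≡ᵇ 1) ∧ (b ≡ᵇ k)))

pairsWhere : ∀ {n} → (ℕ → ℕ → Bool) → List (Edge n)
pairsWhere {n} p =
  concatMap (λ a → concatMap (λ b → if p (toℕ a) (toℕ b) then (a , b) ∷ [] else [])
                             (allFin n))
            (allFin n)

wheelEdges : (k : ℕ) → List (Edge (suc k))
wheelEdges k = pairsWhere (isWheelEdge k)

sameEdge : ℕ → ℕ → ℕ → ℕ → Bool
sameEdge a b c d = (a ≡ᵇ c) ∧ (b ≡ᵇ d)

-- Edge list of  W_k - v_k v_1 v_2 - e,  where e = v v_j (1 ≤ j ≤ k).
wheelMinus : (k j : ℕ) → List (Edge (suc k))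
wheelMinus k j = pairsWhere (λ a b →
  isWheelEdge k a b ∧
  (if sameEdge a b 1 k ∨ sameEdge a b 1 2 ∨ sameEdge a b 0 j then false else true))

-- Expanding ∏ (x − y), the coefficient of a monomial is a signed count of the ways to charge
-- every edge to one of its ends so that each vertex is charged its exponent, an edge charged to
-- its second end contributing −1; since the product is commutative, the edges may be charged in
-- any order.  Vertices with exponent 0 force their edges: the spokes at v₁, v₂, v_k go to the
-- hub v.  For 3 ≤ j < k take v³ ∏_{3 ≤ i < k} v_i²: the hub is then saturated, every other
-- spoke goes to its rim vertex, and the path v₂ ⋯ v_k must be oriented towards v_j, so there
-- is a single term ±1.  For j ∈ {1, 2, k} take v⁴ v₃ ∏_{4 ≤ i < k} v_i²: the spoke v v₃ must
-- go to v (otherwise v₂v₃ cannot be charged), and exactly one spoke v v_m with 4 ≤ m < k goes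
-- to v; the path is then oriented towards v_m, and up to a common sign the term is (−1)^m.
-- These k − 4 terms alternate, and k − 4 is odd, so they add up to ±1.
{-# OPTIONS --safe #-}
module Submission where

open import Defs
open import Data.Bool using (Bool; true; false; _∧_; _∨_; if_then_else_; T)
open import Data.Bool.Properties using (if-float)
open import Data.Nat using (ℕ; zero; suc; _+_; _∸_; _≡ᵇ_; _<ᵇ_; _≤_; _<_; _≟_; s≤s; z≤n)
open import Data.Nat.Properties
  using ( +-comm; +-suc; +-identityʳ; +-mono-≤; ≡ᵇ⇒≡; 0≢1+n; <⇒≢; <⇒≱; ≤⇒≯; ≤∧≢⇒<
        ; n<1+n; n≤1+n; m<n⇒m<1+n; m<m+n; m≤m+n; ≤-refl; ≤-reflexive; ≤-trans; ≤-pred; <-trans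
        ; m≤n⇒∃[o]m+o≡n )
open import Data.Nat.Divisibility using (_∣_; _∣0; ∣-refl; ∣m∣n⇒∣m+n)
open import Data.Fin using (Fin; toℕ)
import Data.Fin as Fin
open import Data.Fin.Properties using (toℕ-injective; toℕ<n)
open import Data.Integer using (ℤ; _-_; _*_; 0ℤ; 1ℤ; -1ℤ; _^_) renaming (_+_ to _+ᶻ_)
import Data.Integer.Properties as ℤ
open import Data.Integer.Tactic.RingSolver using (solve-∀)
open import Data.List
  using (List; []; _∷_; _++_; [_]; map; concatMap; filter; replicate; length; allFin; tabulate)
open import Data.List.Properties
  using ( ++-assoc; ++-identityʳ; length-++; map-concatMap; concatMap-map; concatMap-cong
        ; map-tabulate; filter-all; filter-reject; filter-++ )
open import Data.List.Membership.Propositional using (_∈_; _∉_)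
open import Data.List.Membership.Propositional.Properties using (∈-++⁻; ∈-++⁺ʳ)
open import Data.List.Relation.Unary.Any using (here; there)
open import Data.List.Relation.Unary.All using (All; []; _∷_)
import Data.List.Relation.Unary.All as All
open import Data.List.Relation.Binary.Permutation.Propositional as ↭ using (_↭_)
open import Data.List.Relation.Binary.Permutation.Propositional.Properties
  using (shift; ∈-resp-↭; ∷↭∷ʳ; ++⁺ʳ; map⁺)
open import Data.Product using (Σ; Σ-syntax; _×_; _,_; proj₁; proj₂)
import Data.Product as Product
open import Data.Sum using (_⊎_; inj₁; inj₂)
open import Function using (_∘_)
open import Relation.Nullary using (¬_; ¬?; Dec; yes; no)
open import Relation.Nullary.Negation using (contradiction)
open import Relation.Binary.PropositionalEquality
  using (_≡_; _≢_; _≗_; refl; sym; trans; cong; cong₂; subst; module ≡-Reasoning)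

Exponents : Set
Exponents = ℕ → ℕ

_[_≔_] : Exponents → ℕ → ℕ → Exponents
(α [ z ≔ d ]) i = if i ≡ᵇ z then d else α i

≡ᵇ-refl : ∀ n → (n ≡ᵇ n) ≡ true
≡ᵇ-refl zero    = refl
≡ᵇ-refl (suc n) = ≡ᵇ-refl n

≢⇒≡ᵇ-false : ∀ {m n} → m ≢ n → (m ≡ᵇ n) ≡ false
≢⇒≡ᵇ-false {m} {n} m≢n with m ≡ᵇ n in eq
... | false = refl
... | true  = contradiction (≡ᵇ⇒≡ m n (subst T (sym eq) _)) m≢n

[≔]-same : ∀ α z d → (α [ z ≔ d ]) z ≡ d
[≔]-same α z d rewrite ≡ᵇ-refl z = refl

[≔]-other : ∀ α d {z i} → i ≢ z → (α [ z ≔ d ]) i ≡ α i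
[≔]-other α d i≢z rewrite ≢⇒≡ᵇ-false i≢z = refl

[≔]-comm : ∀ α {x u} d e → x ≢ u → (α [ x ≔ d ]) [ u ≔ e ] ≗ (α [ u ≔ e ]) [ x ≔ d ]
[≔]-comm α {x} {u} d e x≢u i with i ≟ x | i ≟ u
... | yes refl | yes refl = contradiction refl x≢u
... | yes refl | no i≢u   =
  trans ([≔]-other (α [ i ≔ d ]) e i≢u) (trans ([≔]-same α i d) (sym ([≔]-same (α [ u ≔ e ]) i d)))
... | no i≢x   | yes refl =
  trans ([≔]-same (α [ x ≔ d ]) i e) (sym (trans ([≔]-other (α [ i ≔ e ]) d i≢x) ([≔]-same α i e)))
... | no i≢x   | no i≢u   =
  trans ([≔]-other (α [ x ≔ d ]) e i≢u) (trans ([≔]-other α d i≢x)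
    (sym (trans ([≔]-other (α [ u ≔ e ]) d i≢x) ([≔]-other α e i≢u))))

[≔]-cong : ∀ {α β} z d → α ≗ β → α [ z ≔ d ] ≗ β [ z ≔ d ]
[≔]-cong z d α≗β i with i ≡ᵇ z
... | true  = refl
... | false = α≗β i

vanishesBelow : ℕ → Exponents → Bool
vanishesBelow zero    α = true
vanishesBelow (suc n) α = (α 0 ≡ᵇ 0) ∧ vanishesBelow n (α ∘ suc)

vanishesBelow-cong : ∀ n {α β} → α ≗ β → vanishesBelow n α ≡ vanishesBelow n β
vanishesBelow-cong zero    α≗β = refl
vanishesBelow-cong (suc n) α≗β =
  cong₂ _∧_ (cong (_≡ᵇ 0) (α≗β 0)) (vanishesBelow-cong n (α≗β ∘ suc))

vanishesBelow-zero : ∀ n → vanishesBelow n (λ _ → 0) ≡ true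
vanishesBelow-zero zero    = refl
vanishesBelow-zero (suc n) = vanishesBelow-zero n

vanishesBelow-nonzero : ∀ {n α z} → z < n → α z ≢ 0 → vanishesBelow n α ≡ false
vanishesBelow-nonzero {suc n} {α} {zero} _ αz≢0 with α 0
... | zero  = contradiction refl αz≢0
... | suc _ = refl
vanishesBelow-nonzero {suc n} {α} {suc z} (s≤s z<n) αz≢0 with α 0 ≡ᵇ 0
... | false = refl
... | true  = vanishesBelow-nonzero {n} {α ∘ suc} z<n αz≢0

Congruent : (Exponents → ℤ) → Set
Congruent f = ∀ {α β} → α ≗ β → f α ≡ f β

-- f at α / x_z, or 0 when x_z does not divide α: the coefficient of α in x_z · Q is that of
-- α / x_z in Q.
divide : ℕ → (Exponents → ℤ) → Exponents → ℤ
divide z f α with α z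
... | zero  = 0ℤ
... | suc d = f (α [ z ≔ d ])

divide-suc : ∀ {z f α d} → α z ≡ suc d → divide z f α ≡ f (α [ z ≔ d ])
divide-suc {z} {f} {α} αz≡suc with α z | αz≡suc
... | _ | refl = refl

divide-vanishes : ∀ {z f α} → (∀ {d} → α z ≡ suc d → f (α [ z ≔ d ]) ≡ 0ℤ) → divide z f α ≡ 0ℤ
divide-vanishes {z} {f} {α} f≡0 with α z
... | zero  = refl
... | suc d = f≡0 refl

divide-zero : ∀ {z f α} → α z ≡ 0 → divide z f α ≡ 0ℤ
divide-zero {z} {f} {α} αz≡0 with α z | αz≡0
... | _ | refl = refl

divide-congruent : ∀ {z f} → Congruent f → Congruent (divide z f)
divide-congruent {z} f-cong {α} {β} α≗β with α z | β z | α≗β z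
... | zero  | zero  | _    = refl
... | suc d | suc d | refl = f-cong ([≔]-cong z d α≗β)

divide-cong : ∀ {z f g} → f ≗ g → divide z f ≗ divide z g
divide-cong {z} f≗g α with α z
... | zero  = refl
... | suc d = f≗g (α [ z ≔ d ])

divide-minus : ∀ z f g α → divide z (λ β → f β - g β) α ≡ divide z f α - divide z g α
divide-minus z f g α with α z
... | zero  = refl
... | suc d = refl

divide-comm : ∀ {f} → Congruent f → ∀ x u α → divide x (divide u f) α ≡ divide u (divide x f) α
divide-comm {f} f-cong x u α with x ≟ u
... | yes refl = refl
... | no x≢u with α x in αx | α u in αu
...   | zero  | zero  = refl
...   | zero  | suc e = sym (divide-zero {x} {f} {α [ u ≔ e ]} (trans ([≔]-other α e x≢u) αx))
...   | suc d | zero  = divide-zero {u} {f} {α [ x ≔ d ]} (trans ([≔]-other α d (x≢u ∘ sym)) αu)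
...   | suc d | suc e = begin
  divide u f (α [ x ≔ d ])     ≡⟨ divide-suc {u} {f} {α [ x ≔ d ]} (trans ([≔]-other α d (x≢u ∘ sym)) αu) ⟩
  f ((α [ x ≔ d ]) [ u ≔ e ])  ≡⟨ f-cong ([≔]-comm α d e x≢u) ⟩
  f ((α [ u ≔ e ]) [ x ≔ d ])  ≡⟨ divide-suc {x} {f} {α [ u ≔ e ]} (trans ([≔]-other α e x≢u) αx) ⟨
  divide x f (α [ u ≔ e ])     ∎
  where open ≡-Reasoning

monomial : List ℕ → Exponents
monomial []       i = 0
monomial (x ∷ xs) i = if i ≡ᵇ x then suc (monomial xs i) else monomial xs i

monomial-here : ∀ x xs → monomial (x ∷ xs) x ≡ suc (monomial xs x)
monomial-here x xs rewrite ≡ᵇ-refl x = refl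

monomial-there : ∀ {x i} xs → i ≢ x → monomial (x ∷ xs) i ≡ monomial xs i
monomial-there xs i≢x rewrite ≢⇒≡ᵇ-false i≢x = refl

monomial-head≢0 : ∀ x xs → monomial (x ∷ xs) x ≢ 0
monomial-head≢0 x xs eq = 0≢1+n (trans (sym eq) (monomial-here x xs))

monomial-∉ : ∀ {x xs} → x ∉ xs → monomial xs x ≡ 0
monomial-∉ {x} {[]}     _    = refl
monomial-∉ {x} {y ∷ ys} x∉xs =
  trans (monomial-there ys (x∉xs ∘ here)) (monomial-∉ (x∉xs ∘ there))

monomial-↭ : ∀ {xs ys} → xs ↭ ys → monomial xs ≗ monomial ys
monomial-↭ ↭.refl           i = refl
monomial-↭ (↭.prep x p)     i = cong (λ m → if i ≡ᵇ x then suc m else m) (monomial-↭ p i)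
monomial-↭ (↭.swap x y p)   i with i ≡ᵇ x | i ≡ᵇ y
... | true  | true  = cong (suc ∘ suc) (monomial-↭ p i)
... | true  | false = cong suc (monomial-↭ p i)
... | false | true  = cong suc (monomial-↭ p i)
... | false | false = monomial-↭ p i
monomial-↭ (↭.trans p q)    i = trans (monomial-↭ p i) (monomial-↭ q i)

monomial-++ : ∀ xs ys i → monomial (xs ++ ys) i ≡ monomial xs i + monomial ys i
monomial-++ []       ys i = refl
monomial-++ (x ∷ xs) ys i with i ≡ᵇ x
... | true  = cong suc (monomial-++ xs ys i)
... | false = monomial-++ xs ys i

divide-here : ∀ {f} → Congruent f → ∀ x xs → divide x f (monomial (x ∷ xs)) ≡ f (monomial xs)
divide-here {f} f-cong x xs =
  trans (divide-suc {x} {f} {monomial (x ∷ xs)} (monomial-here x xs)) (f-cong lowered)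
  where
  lowered : monomial (x ∷ xs) [ x ≔ monomial xs x ] ≗ monomial xs
  lowered i with i ≟ x
  ... | yes refl = [≔]-same (monomial (i ∷ xs)) i (monomial xs i)
  ... | no i≢x   = trans ([≔]-other (monomial (x ∷ xs)) (monomial xs x) i≢x) (monomial-there xs i≢x)

divide-∉ : ∀ {f x xs} → x ∉ xs → divide x f (monomial xs) ≡ 0ℤ
divide-∉ {f} {x} {xs} x∉xs = divide-zero {x} {f} {monomial xs} (monomial-∉ x∉xs)

∉-++ : ∀ {x : ℕ} {xs ys} → x ∉ xs → x ∉ ys → x ∉ xs ++ ys
∉-++ {xs = xs} x∉xs x∉ys x∈ with ∈-++⁻ xs x∈
... | inj₁ x∈xs = x∉xs x∈xs
... | inj₂ x∈ys = x∉ys x∈ys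

∉-∷ : ∀ {x y : ℕ} {ys} → x ≢ y → x ∉ ys → x ∉ y ∷ ys
∉-∷ x≢y x∉ys (here x≡y)  = x≢y x≡y
∉-∷ x≢y x∉ys (there x∈) = x∉ys x∈

range : ℕ → ℕ → List ℕ
range s zero    = []
range s (suc c) = s ∷ range (suc s) c

∉-range-below : ∀ {i s} c → i < s → i ∉ range s c
∉-range-below (suc c) i<s (here refl) = <⇒≢ i<s refl
∉-range-below (suc c) i<s (there i∈) = ∉-range-below c (m<n⇒m<1+n i<s) i∈

∉-range-above : ∀ {i s} c → s + c ≤ i → i ∉ range s c
∉-range-above {i} {s} (suc c) s+c≤i (here refl) =
  <⇒≱ (subst (s <_) (sym (+-suc s c)) (s≤s (m≤m+n s c))) s+c≤i
∉-range-above {i} {s} (suc c) s+c≤i (there i∈) =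
  ∉-range-above c (subst (_≤ i) (+-suc s c) s+c≤i) i∈

∉-range : ∀ {i s} c → i < s ⊎ s + c ≤ i → i ∉ range s c
∉-range c (inj₁ i<s)   = ∉-range-below c i<s
∉-range c (inj₂ s+c≤i) = ∉-range-above c s+c≤i

∈-range⁺ : ∀ {i} s c → s ≤ i → i < s + c → i ∈ range s c
∈-range⁺ {i} s zero    s≤i i<s+0 = contradiction (subst (i <_) (+-identityʳ s) i<s+0) (≤⇒≯ s≤i)
∈-range⁺ {i} s (suc c) s≤i i<s+c with s ≟ i
... | yes refl = here refl
... | no s≢i   = there (∈-range⁺ (suc s) c (≤∧≢⇒< s≤i s≢i) (subst (i <_) (+-suc s c) i<s+c))

∈-range⁻ : ∀ {m} s c → m ∈ range s c → Σ[ a ∈ ℕ ] Σ[ b ∈ ℕ ] m ≡ s + a × c ≡ a + suc b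
∈-range⁻ s (suc c) (here refl) = 0 , c , sym (+-identityʳ s) , refl
∈-range⁻ s (suc c) (there m∈) with ∈-range⁻ (suc s) c m∈
... | a , b , refl , refl = suc a , b , sym (+-suc s a) , refl

range-++ : ∀ s a b → range s (a + b) ≡ range s a ++ range (s + a) b
range-++ s zero    b = cong (λ t → range t b) (sym (+-identityʳ s))
range-++ s (suc a) b = cong (s ∷_) (begin
  range (suc s) (a + b)                ≡⟨ range-++ (suc s) a b ⟩
  range (suc s) a ++ range (suc s + a) b ≡⟨ cong (λ t → range (suc s) a ++ range t b) (+-suc s a) ⟨
  range (suc s) a ++ range (s + suc a) b ∎)
  where open ≡-Reasoning

range-∷ʳ : ∀ s c → range s (suc c) ≡ range s c ++ [ s + c ]
range-∷ʳ s c = trans (cong (range s) (+-comm 1 c)) (range-++ s c 1)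

length-range : ∀ s c → length (range s c) ≡ c
length-range s zero    = refl
length-range s (suc c) = cong suc (length-range (suc s) c)

range-hole-↭ : ∀ s a b → range s (a + suc b) ↭ (s + a) ∷ range s a ++ range (suc (s + a)) b
range-hole-↭ s a b =
  ↭.trans (↭.↭-reflexive (range-++ s a (suc b))) (shift (s + a) (range s a) (range (suc (s + a)) b))

range-with-extra-↭ : ∀ s a b →
  (s + a) ∷ range s (a + suc b) ↭ range s (suc a) ++ range (s + a) (suc b)
range-with-extra-↭ s a b = begin
  (s + a) ∷ range s (a + suc b)
    ≡⟨ cong ((s + a) ∷_) (range-++ s a (suc b)) ⟩
  (s + a) ∷ range s a ++ (s + a) ∷ range (suc (s + a)) b
    ↭⟨ shift (s + a) (range s a) _ ⟨
  range s a ++ [ s + a ] ++ (s + a) ∷ range (suc (s + a)) b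
    ≡⟨ ++-assoc (range s a) [ s + a ] _ ⟨
  (range s a ++ [ s + a ]) ++ range (s + a) (suc b)
    ≡⟨ cong (_++ range (s + a) (suc b)) (range-∷ʳ s a) ⟨
  range s (suc a) ++ range (s + a) (suc b)
    ∎
  where open ↭.PermutationReasoning

range-last-to-front : ∀ xs s c → xs ++ range s (suc c) ↭ (s + c) ∷ xs ++ range s c
range-last-to-front xs s c = begin
  xs ++ range s (suc c)          ≡⟨ cong (xs ++_) (range-∷ʳ s c) ⟩
  xs ++ range s c ++ [ s + c ]   ≡⟨ ++-assoc xs (range s c) [ s + c ] ⟨
  (xs ++ range s c) ++ [ s + c ] ↭⟨ ∷↭∷ʳ (s + c) (xs ++ range s c) ⟨
  (s + c) ∷ xs ++ range s c      ∎
  where open ↭.PermutationReasoning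

monomial-range-≤1 : ∀ s c i → monomial (range s c) i ≤ 1
monomial-range-≤1 s zero    i = z≤n
monomial-range-≤1 s (suc c) i with i ≟ s
... | yes refl = ≤-reflexive (trans (monomial-here i (range (suc i) c))
                                    (cong suc (monomial-∉ (∉-range-below c (n<1+n i)))))
... | no i≢s   = subst (_≤ 1) (sym (monomial-there (range (suc s) c) i≢s)) (monomial-range-≤1 (suc s) c i)

monomial-two-ranges-≤2 : ∀ s c s′ c′ i → monomial (range s c ++ range s′ c′) i ≤ 2
monomial-two-ranges-≤2 s c s′ c′ i = ≤-trans (≤-reflexive (monomial-++ (range s c) (range s′ c′) i))
                                             (+-mono-≤ (monomial-range-≤1 s c i) (monomial-range-≤1 s′ c′ i))

infix 4 _≢?_

_≢?_ : (i t : ℕ) → Dec (i ≢ t)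
i ≢? t = ¬? (i ≟ t)

filter-≢-∉ : ∀ {t} xs → t ∉ xs → filter (_≢? t) xs ≡ xs
filter-≢-∉ {t} xs t∉xs =
  filter-all (_≢? t) (All.tabulate λ i∈xs i≡t → t∉xs (subst (_∈ xs) i≡t i∈xs))

filter-range-hole : ∀ s x y →
  filter (_≢? s + x) (range s (x + suc y)) ≡ range s x ++ range (suc (s + x)) y
filter-range-hole s x y = begin
  filter (_≢? s + x) (range s (x + suc y))
    ≡⟨ cong (filter (_≢? s + x)) (range-++ s x (suc y)) ⟩
  filter (_≢? s + x) (range s x ++ (s + x) ∷ range (suc (s + x)) y)
    ≡⟨ filter-++ (_≢? s + x) (range s x) _ ⟩
  filter (_≢? s + x) (range s x) ++ filter (_≢? s + x) ((s + x) ∷ range (suc (s + x)) y)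
    ≡⟨ cong₂ _++_ (filter-≢-∉ (range s x) (∉-range-above x ≤-refl))
                  (trans (filter-reject (_≢? s + x) (λ s+x≢s+x → s+x≢s+x refl))
                         (filter-≢-∉ (range (suc (s + x)) y) (∉-range-below y (n<1+n (s + x))))) ⟩
  range s x ++ range (suc (s + x)) y
    ∎
  where open ≡-Reasoning

filter-range-last : ∀ s c → filter (_≢? s + c) (range s (suc c)) ≡ range s c
filter-range-last s c = begin
  filter (_≢? s + c) (range s (suc c))                            ≡⟨ cong (filter (_≢? s + c)) (range-∷ʳ s c) ⟩
  filter (_≢? s + c) (range s c ++ [ s + c ])                     ≡⟨ filter-++ (_≢? s + c) (range s c) _ ⟩
  filter (_≢? s + c) (range s c) ++ filter (_≢? s + c) [ s + c ]
    ≡⟨ cong₂ _++_ (filter-≢-∉ (range s c) (∉-range-above c ≤-refl))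
                  (filter-reject (_≢? s + c) (λ s+c≢s+c → s+c≢s+c refl)) ⟩
  range s c ++ []                                                 ≡⟨ ++-identityʳ (range s c) ⟩
  range s c                                                       ∎
  where open ≡-Reasoning

∑ : List ℕ → (ℕ → ℤ) → ℤ
∑ []       f = 0ℤ
∑ (m ∷ ms) f = f m +ᶻ ∑ ms f

syntax ∑ ms (λ m → e) = ∑[ m ∈ ms ] e

∑-cong-∈ : ∀ {f g} ms → (∀ {m} → m ∈ ms → f m ≡ g m) → ∑ ms f ≡ ∑ ms g
∑-cong-∈ []       _   = refl
∑-cong-∈ (m ∷ ms) f≡g = cong₂ _+ᶻ_ (f≡g (here refl)) (∑-cong-∈ ms (f≡g ∘ there))

negate-by-sign : ∀ x → 0ℤ - x ≡ -1ℤ * x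
negate-by-sign = solve-∀

negate-twice : ∀ x → -1ℤ * (-1ℤ * x) ≡ x
negate-twice = solve-∀

-1^≢0 : ∀ m → -1ℤ ^ m ≢ 0ℤ
-1^≢0 zero    ()
-1^≢0 (suc m) -1^m+1≡0 = -1^≢0 m (trans (sym (negate-twice (-1ℤ ^ m))) (cong (-1ℤ *_) -1^m+1≡0))

-1^-even : ∀ t → -1ℤ ^ (t + t) ≡ 1ℤ
-1^-even zero    = refl
-1^-even (suc t) rewrite +-suc t t = trans (negate-twice (-1ℤ ^ (t + t))) (-1^-even t)

∑-alternating : ∀ s t → (∑[ m ∈ range s (suc (t + t)) ] (-1ℤ ^ m)) ≡ -1ℤ ^ s
∑-alternating s zero    = ℤ.+-identityʳ (-1ℤ ^ s)
∑-alternating s (suc t) rewrite +-suc t t =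
  trans (cong (λ x → -1ℤ ^ s +ᶻ (-1ℤ ^ suc s +ᶻ x)) (∑-alternating (suc (suc s)) t))
        (cancel (-1ℤ ^ s))
  where
  cancel : ∀ x → x +ᶻ (-1ℤ * x +ᶻ -1ℤ * (-1ℤ * x)) ≡ x
  cancel = solve-∀

odd⇒suc-double : ∀ n → ¬ 2 ∣ n → Σ[ t ∈ ℕ ] n ≡ suc (t + t)
odd⇒suc-double zero          ¬2∣n = contradiction (2 ∣0) ¬2∣n
odd⇒suc-double (suc zero)    _    = 0 , refl
odd⇒suc-double (suc (suc n)) ¬2∣n with odd⇒suc-double n (¬2∣n ∘ ∣m∣n⇒∣m+n ∣-refl)
... | t , refl = suc t , cong (suc ∘ suc) (sym (+-suc t t))

-- The coefficient of a monomial in a product of differences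

Isolated : ℕ → List (ℕ × ℕ) → Set
Isolated z = All (λ e → proj₁ e ≢ z × proj₂ e ≢ z)

spokes : ℕ → List ℕ → List (ℕ × ℕ)
spokes c = map (c ,_)

path : ℕ → ℕ → List (ℕ × ℕ)
path s c = map (λ i → i , suc i) (range s c)

path-isolated : ∀ {z s} c → z < s → Isolated z (path s c)
path-isolated zero    z<s = []
path-isolated (suc c) z<s =
  (<⇒≢ z<s ∘ sym , <⇒≢ (m<n⇒m<1+n z<s) ∘ sym) ∷ path-isolated c (m<n⇒m<1+n z<s)

spokes-↭ : ∀ c {bs cs} R → bs ↭ cs → spokes c bs ++ R ↭ spokes c cs ++ R
spokes-↭ c R bs↭cs = ++⁺ʳ R (map⁺ (c ,_) bs↭cs)

exponent-≢ : ∀ {α : Exponents} {x w d} → α x ≡ 0 → α w ≡ suc d → x ≢ w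
exponent-≢ αx≡0 αw≡suc refl = 0≢1+n (trans (sym αx≡0) αw≡suc)

module _ (n : ℕ) where

  -- Defs.coeff with vertices labelled by natural numbers, in the variables x₀, …, x_{n−1}.
  coeffℕ : List (ℕ × ℕ) → Exponents → ℤ
  coeffℕ []             α = if vanishesBelow n α then 1ℤ else 0ℤ
  coeffℕ ((x , y) ∷ es) α = divide x (coeffℕ es) α - divide y (coeffℕ es) α

  coeffℕ-congruent : ∀ es → Congruent (coeffℕ es)
  coeffℕ-congruent []             α≗β = cong (if_then 1ℤ else 0ℤ) (vanishesBelow-cong n α≗β)
  coeffℕ-congruent ((x , y) ∷ es) α≗β =
    cong₂ _-_ (divide-congruent (coeffℕ-congruent es) α≗β) (divide-congruent (coeffℕ-congruent es) α≗β)

  coeffℕ-monomial-↭ : ∀ es {xs ys} → xs ↭ ys → coeffℕ es (monomial xs) ≡ coeffℕ es (monomial ys)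
  coeffℕ-monomial-↭ es p = coeffℕ-congruent es (monomial-↭ p)

  coeffℕ-swap : ∀ e₁ e₂ es → coeffℕ (e₁ ∷ e₂ ∷ es) ≗ coeffℕ (e₂ ∷ e₁ ∷ es)
  coeffℕ-swap (x , y) (u , v) es α = begin
    coeffℕ ((x , y) ∷ (u , v) ∷ es) α ≡⟨ cong₂ _-_ (expand x) (expand y) ⟩
    (D x u - D x v) - (D y u - D y v) ≡⟨ cong₂ (λ a b → (a - b) - (D y u - D y v)) (comm x u) (comm x v) ⟩
    (D u x - D v x) - (D y u - D y v) ≡⟨ cong₂ (λ a b → (D u x - D v x) - (a - b)) (comm y u) (comm y v) ⟩
    (D u x - D v x) - (D u y - D v y) ≡⟨ exchange (D u x) (D v x) (D u y) (D v y) ⟩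
    (D u x - D u y) - (D v x - D v y) ≡⟨ cong₂ _-_ (expand u) (expand v) ⟨
    coeffℕ ((u , v) ∷ (x , y) ∷ es) α ∎
    where
    open ≡-Reasoning
    D : ℕ → ℕ → ℤ
    D a b = divide a (divide b (coeffℕ es)) α
    expand : ∀ {a b} c → divide c (coeffℕ ((a , b) ∷ es)) α ≡ D c a - D c b
    expand {a} {b} c = divide-minus c (divide a (coeffℕ es)) (divide b (coeffℕ es)) α
    comm : ∀ a b → D a b ≡ D b a
    comm a b = divide-comm (coeffℕ-congruent es) a b α
    exchange : ∀ a b c d → (a - b) - (c - d) ≡ (a - c) - (b - d)
    exchange = solve-∀

  coeffℕ-prep : ∀ e {es fs} → coeffℕ es ≗ coeffℕ fs → coeffℕ (e ∷ es) ≗ coeffℕ (e ∷ fs)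
  coeffℕ-prep (x , y) es≗fs α = cong₂ _-_ (divide-cong es≗fs α) (divide-cong es≗fs α)

  coeffℕ-↭ : ∀ {es fs} → es ↭ fs → coeffℕ es ≗ coeffℕ fs
  coeffℕ-↭ ↭.refl                        = λ _ → refl
  coeffℕ-↭ (↭.prep {xs} {ys} e p)        = coeffℕ-prep e {xs} {ys} (coeffℕ-↭ p)
  coeffℕ-↭ (↭.swap {xs} {ys} e₁ e₂ p) α  =
    trans (coeffℕ-swap e₁ e₂ xs α)
          (coeffℕ-prep e₂ {e₁ ∷ xs} {e₁ ∷ ys} (coeffℕ-prep e₁ {xs} {ys} (coeffℕ-↭ p)) α)
  coeffℕ-↭ (↭.trans p q)               α = trans (coeffℕ-↭ p α) (coeffℕ-↭ q α)

  coeffℕ-zero-edge : ∀ {x y es α} → (x , y) ∈ es → α x ≡ 0 → α y ≡ 0 → coeffℕ es α ≡ 0ℤ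
  coeffℕ-zero-edge {x} {y} {_ ∷ es} {α} (here refl) αx αy =
    cong₂ _-_ (divide-zero {x} {coeffℕ es} {α} αx) (divide-zero {y} {coeffℕ es} {α} αy)
  coeffℕ-zero-edge {x} {y} {(u , v) ∷ es} {α} (there xy∈es) αx αy = cong₂ _-_ (branch u) (branch v)
    where
    branch : ∀ w → divide w (coeffℕ es) α ≡ 0ℤ
    branch w = divide-vanishes {w} {coeffℕ es} {α} λ {d} αw →
      coeffℕ-zero-edge {α = α [ w ≔ d ]} xy∈es
        (trans ([≔]-other α d (exponent-≢ αx αw)) αx) (trans ([≔]-other α d (exponent-≢ αy αw)) αy)

  coeffℕ-isolated : ∀ {z es α} → z < n → α z ≢ 0 → Isolated z es → coeffℕ es α ≡ 0ℤ
  coeffℕ-isolated z<n αz≢0 [] = cong (if_then 1ℤ else 0ℤ) (vanishesBelow-nonzero z<n αz≢0)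
  coeffℕ-isolated {z} {(x , y) ∷ es} {α} z<n αz≢0 ((x≢z , y≢z) ∷ z-isolated) =
    cong₂ _-_ (branch x≢z) (branch y≢z)
    where
    branch : ∀ {w} → w ≢ z → divide w (coeffℕ es) α ≡ 0ℤ
    branch {w} w≢z = divide-vanishes {w} {coeffℕ es} {α} λ {d} _ →
      coeffℕ-isolated {α = α [ w ≔ d ]} z<n (αz≢0 ∘ trans (sym ([≔]-other α d (w≢z ∘ sym)))) z-isolated

  coeffℕ-path-forward : ∀ s b → s + b < n → coeffℕ (path s b) (monomial (range s b)) ≡ 1ℤ
  coeffℕ-path-forward s zero    _     = cong (if_then 1ℤ else 0ℤ) (vanishesBelow-zero n)
  coeffℕ-path-forward s (suc b) s+b<n = cong₂ _-_ charge-s charge-s+1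
    where
    s+b+1<n : suc (s + b) < n
    s+b+1<n = subst (_< n) (+-suc s b) s+b<n
    μ : Exponents
    μ = monomial (range s (suc b))
    charge-s : divide s (coeffℕ (path (suc s) b)) μ ≡ 1ℤ
    charge-s = trans (divide-here (coeffℕ-congruent (path (suc s) b)) s (range (suc s) b))
                     (coeffℕ-path-forward (suc s) b s+b+1<n)
    charge-s+1 : divide (suc s) (coeffℕ (path (suc s) b)) μ ≡ 0ℤ
    charge-s+1 = divide-vanishes {suc s} {coeffℕ (path (suc s) b)} {μ} λ {d} _ →
      coeffℕ-isolated (<-trans (s≤s (m≤m+n s b)) s+b+1<n)
        (monomial-head≢0 s (range (suc s) b) ∘ trans (sym ([≔]-other μ d (<⇒≢ (n<1+n s)))))
        (path-isolated b (n<1+n s))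

  -- Only the orientation of the path towards its sink m = s + a contributes; the a edges
  -- before the sink are charged to their second ends.
  coeffℕ-path-sink : ∀ a s m b → s + a ≡ m → m + b < n →
    coeffℕ (path s (a + b)) (monomial (range (suc s) a ++ range m b)) ≡ -1ℤ ^ a
  coeffℕ-path-sink zero s m b s+0≡m m+b<n with refl ← trans (sym (+-identityʳ s)) s+0≡m =
    coeffℕ-path-forward s b m+b<n
  coeffℕ-path-sink (suc a) s m b s+a≡m m+b<n = begin
    coeffℕ (path s (suc a + b)) (monomial sink) ≡⟨ cong₂ _-_ (divide-∉ s∉sink) charge-s+1 ⟩
    0ℤ - -1ℤ ^ a                                ≡⟨ negate-by-sign (-1ℤ ^ a) ⟩
    -1ℤ ^ suc a                                 ∎
    where
    open ≡-Reasoning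
    sink : List ℕ
    sink = range (suc s) (suc a) ++ range m b
    s∉sink : s ∉ sink
    s∉sink = ∉-++ (∉-range-below (suc a) (n<1+n s))
                  (∉-range-below b (subst (s <_) s+a≡m (m<m+n s (s≤s z≤n))))
    charge-s+1 : divide (suc s) (coeffℕ (path (suc s) (a + b))) (monomial sink) ≡ -1ℤ ^ a
    charge-s+1 =
      trans (divide-here (coeffℕ-congruent (path (suc s) (a + b))) (suc s) (range (suc (suc s)) a ++ range m b))
            (coeffℕ-path-sink a (suc s) m b (trans (sym (+-suc s a)) s+a≡m) m+b<n)

  coeffℕ-path-with-extra : ∀ s a b → suc s + a + suc b < n →
    coeffℕ (path s (suc (a + suc b))) (monomial ((suc s + a) ∷ range (suc s) (a + suc b))) ≡ -1ℤ ^ suc a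
  coeffℕ-path-with-extra s a b bound = begin
    coeffℕ (path s (suc a + suc b)) (monomial ((suc s + a) ∷ range (suc s) (a + suc b)))
      ≡⟨ coeffℕ-monomial-↭ (path s (suc a + suc b)) (range-with-extra-↭ (suc s) a b) ⟩
    coeffℕ (path s (suc a + suc b)) (monomial (range (suc s) (suc a) ++ range (suc s + a) (suc b)))
      ≡⟨ coeffℕ-path-sink (suc a) s (suc s + a) (suc b) (+-suc s a) bound ⟩
    -1ℤ ^ suc a
      ∎
    where open ≡-Reasoning

  coeffℕ-spokes-to-centre : ∀ c ws {ms R} → All (_∉ replicate (length ws) c ++ ms) ws →
    coeffℕ (spokes c ws ++ R) (monomial (replicate (length ws) c ++ ms)) ≡ coeffℕ R (monomial ms)
  coeffℕ-spokes-to-centre c []       _            = refl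
  coeffℕ-spokes-to-centre c (w ∷ ws) {ms} {R} (w∉ ∷ ws∉) = begin
    coeffℕ (spokes c (w ∷ ws) ++ R) (monomial (c ∷ rest))
      ≡⟨ cong₂ _-_ (divide-here (coeffℕ-congruent (spokes c ws ++ R)) c rest) (divide-∉ w∉) ⟩
    coeffℕ (spokes c ws ++ R) (monomial rest) - 0ℤ
      ≡⟨ ℤ.+-identityʳ _ ⟩
    coeffℕ (spokes c ws ++ R) (monomial rest)
      ≡⟨ coeffℕ-spokes-to-centre c ws (All.map (_∘ there) ws∉) ⟩
    coeffℕ R (monomial ms)
      ∎
    where
    open ≡-Reasoning
    rest : List ℕ
    rest = replicate (length ws) c ++ ms

  coeffℕ-spokes-to-leaves : ∀ c bs {ms R} → c ∉ bs ++ ms →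
    coeffℕ (spokes c bs ++ R) (monomial (bs ++ ms)) ≡ -1ℤ ^ length bs * coeffℕ R (monomial ms)
  coeffℕ-spokes-to-leaves c []       {ms} {R} _   = sym (ℤ.*-identityˡ (coeffℕ R (monomial ms)))
  coeffℕ-spokes-to-leaves c (b ∷ bs) {ms} {R} c∉ = begin
    coeffℕ (spokes c (b ∷ bs) ++ R) (monomial (b ∷ bs ++ ms))
      ≡⟨ cong₂ _-_ (divide-∉ c∉) charge-b ⟩
    0ℤ - ε * X
      ≡⟨ negate-by-sign (ε * X) ⟩
    -1ℤ * (ε * X)
      ≡⟨ ℤ.*-assoc -1ℤ ε X ⟨
    -1ℤ ^ length (b ∷ bs) * X
      ∎
    where
    open ≡-Reasoning
    ε X : ℤ
    ε = -1ℤ ^ length bs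
    X = coeffℕ R (monomial ms)
    charge-b : divide b (coeffℕ (spokes c bs ++ R)) (monomial (b ∷ bs ++ ms)) ≡ ε * X
    charge-b = trans (divide-here (coeffℕ-congruent (spokes c bs ++ R)) b (bs ++ ms))
                     (coeffℕ-spokes-to-leaves c bs (c∉ ∘ there))

  coeffℕ-spokes-one-to-centre : ∀ c bs {ms R} → c < n → c ∉ bs ++ ms → Isolated c R →
    coeffℕ (spokes c bs ++ R) (monomial (c ∷ bs ++ ms))
      ≡ -1ℤ ^ suc (length bs) * ∑[ m ∈ bs ] coeffℕ R (monomial (m ∷ ms))
  coeffℕ-spokes-one-to-centre c [] {ms} c<n _ c-isolated =
    coeffℕ-isolated c<n (monomial-head≢0 c ms) c-isolated
  coeffℕ-spokes-one-to-centre c (b ∷ bs) {ms} {R} c<n c∉ c-isolated = begin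
    coeffℕ (spokes c (b ∷ bs) ++ R) (monomial (c ∷ b ∷ bs ++ ms)) ≡⟨ cong₂ _-_ charge-c charge-b ⟩
    ε * X - (-1ℤ * ε) * S                                         ≡⟨ collect ε X S ⟩
    (-1ℤ * (-1ℤ * ε)) * (X +ᶻ S)                                  ∎
    where
    open ≡-Reasoning
    C : Exponents → ℤ
    C = coeffℕ (spokes c bs ++ R)
    C-congruent : Congruent C
    C-congruent = coeffℕ-congruent (spokes c bs ++ R)
    ε X S : ℤ
    ε = -1ℤ ^ length bs
    X = coeffℕ R (monomial (b ∷ ms))
    S = ∑[ m ∈ bs ] coeffℕ R (monomial (m ∷ ms))
    charge-c : divide c C (monomial (c ∷ b ∷ bs ++ ms)) ≡ ε * X
    charge-c = begin
      divide c C (monomial (c ∷ b ∷ bs ++ ms)) ≡⟨ divide-here C-congruent c (b ∷ bs ++ ms) ⟩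
      C (monomial (b ∷ bs ++ ms))
        ≡⟨ coeffℕ-monomial-↭ (spokes c bs ++ R) (↭.↭-sym (shift b bs ms)) ⟩
      C (monomial (bs ++ b ∷ ms))
        ≡⟨ coeffℕ-spokes-to-leaves c bs (c∉ ∘ ∈-resp-↭ (shift b bs ms)) ⟩
      ε * X                                    ∎
    charge-b : divide b C (monomial (c ∷ b ∷ bs ++ ms)) ≡ (-1ℤ * ε) * S
    charge-b = begin
      divide b C (monomial (c ∷ b ∷ bs ++ ms))
        ≡⟨ divide-congruent {b} {C} C-congruent (monomial-↭ (↭.swap c b (↭.↭-refl {x = bs ++ ms}))) ⟩
      divide b C (monomial (b ∷ c ∷ bs ++ ms))
        ≡⟨ divide-here C-congruent b (c ∷ bs ++ ms) ⟩
      C (monomial (c ∷ bs ++ ms))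
        ≡⟨ coeffℕ-spokes-one-to-centre c bs c<n (c∉ ∘ there) c-isolated ⟩
      (-1ℤ * ε) * S
        ∎
    collect : ∀ e x s → e * x - (-1ℤ * e) * s ≡ (-1ℤ * (-1ℤ * e)) * (x +ᶻ s)
    collect = solve-∀

toℕ-edges : ∀ {n} → List (Edge n) → List (ℕ × ℕ)
toℕ-edges = map (Product.map toℕ toℕ)

allZero-toℕ : ∀ {n} (α : Monomial n) A → (∀ i → α i ≡ A (toℕ i)) → allZero α ≡ vanishesBelow n A
allZero-toℕ {zero}  α A α≡A = refl
allZero-toℕ {suc n} α A α≡A =
  cong₂ _∧_ (cong (_≡ᵇ 0) (α≡A Fin.zero)) (allZero-toℕ (α ∘ Fin.suc) (A ∘ suc) (α≡A ∘ Fin.suc))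

set-toℕ : ∀ {n} (α : Monomial n) A z d → (∀ i → α i ≡ A (toℕ i)) →
  ∀ i → set α z d i ≡ (A [ toℕ z ≔ d ]) (toℕ i)
set-toℕ α A z d α≡A i with i Fin.≟ z
... | yes refl = sym ([≔]-same A (toℕ i) d)
... | no i≢z   = trans (α≡A i) (sym ([≔]-other A d (i≢z ∘ toℕ-injective)))

coeff-toℕ : ∀ {n} (es : List (Edge n)) (α : Monomial n) A → (∀ i → α i ≡ A (toℕ i)) →
  coeff es α ≡ coeffℕ n (toℕ-edges es) A
coeff-toℕ [] α A α≡A = cong (if_then 1ℤ else 0ℤ) (allZero-toℕ α A α≡A)
coeff-toℕ ((x , y) ∷ es) α A α≡A
  with α x | A (toℕ x) | α≡A x | α y | A (toℕ y) | α≡A y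
... | zero  | _ | refl | zero  | _ | refl = refl
... | zero  | _ | refl | suc e | _ | refl = cong (0ℤ -_) (coeff-toℕ es _ _ (set-toℕ α A y e α≡A))
... | suc d | _ | refl | zero  | _ | refl = cong (_- 0ℤ) (coeff-toℕ es _ _ (set-toℕ α A x d α≡A))
... | suc d | _ | refl | suc e | _ | refl =
  cong₂ _-_ (coeff-toℕ es _ _ (set-toℕ α A x d α≡A)) (coeff-toℕ es _ _ (set-toℕ α A y e α≡A))

tabulate-toℕ : ∀ {n} s (f : Fin n → ℕ) → (∀ i → f i ≡ s + toℕ i) → tabulate f ≡ range s n
tabulate-toℕ {zero}  s f f≡ = refl
tabulate-toℕ {suc n} s f f≡ = cong₂ _∷_ (trans (f≡ Fin.zero) (+-identityʳ s))
  (tabulate-toℕ (suc s) (f ∘ Fin.suc) λ i → trans (f≡ (Fin.suc i)) (+-suc s (toℕ i)))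

concatMap-allFin : ∀ {n} {A : Set} (f : ℕ → List A) →
  concatMap (f ∘ toℕ) (allFin n) ≡ concatMap f (range 0 n)
concatMap-allFin {n} f = begin
  concatMap (f ∘ toℕ) (allFin n)   ≡⟨ concatMap-map f toℕ (allFin n) ⟨
  concatMap f (map toℕ (allFin n)) ≡⟨ cong (concatMap f) (map-tabulate {n = n} (λ i → i) toℕ) ⟩
  concatMap f (tabulate {n = n} toℕ) ≡⟨ cong (concatMap f) (tabulate-toℕ {n} 0 toℕ λ _ → refl) ⟩
  concatMap f (range 0 n)          ∎
  where open ≡-Reasoning

row : (ℕ → ℕ → Bool) → ℕ → ℕ → List (ℕ × ℕ)
row p n a = concatMap (λ b → if p a b then [ (a , b) ] else []) (range 0 n)

toℕ-pairsWhere : ∀ {n} p → toℕ-edges (pairsWhere {n} p) ≡ concatMap (row p n) (range 0 n)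
toℕ-pairsWhere {n} p = begin
  toℕ-edges (pairsWhere p)                     ≡⟨ map-concatMap (Product.map toℕ toℕ) pairsFrom (allFin n) ⟩
  concatMap (toℕ-edges ∘ pairsFrom) (allFin n) ≡⟨ concatMap-cong toℕ-row (allFin n) ⟩
  concatMap (row p n ∘ toℕ) (allFin n)         ≡⟨ concatMap-allFin {n} (row p n) ⟩
  concatMap (row p n) (range 0 n)              ∎
  where
  open ≡-Reasoning
  pairsFrom : Fin n → List (Edge n)
  pairsFrom a = concatMap (λ b → if p (toℕ a) (toℕ b) then [ (a , b) ] else []) (allFin n)
  rowFrom : ℕ → ℕ → List (ℕ × ℕ)
  rowFrom a b = if p a b then [ (a , b) ] else []
  toℕ-row : ∀ a → toℕ-edges (pairsFrom a) ≡ row p n (toℕ a)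
  toℕ-row a = begin
    toℕ-edges (pairsFrom a)
      ≡⟨ map-concatMap (Product.map toℕ toℕ) _ (allFin n) ⟩
    concatMap (λ b → toℕ-edges (if p (toℕ a) (toℕ b) then [ (a , b) ] else [])) (allFin n)
      ≡⟨ concatMap-cong (λ b → if-float toℕ-edges (p (toℕ a) (toℕ b))) (allFin n) ⟩
    concatMap (rowFrom (toℕ a) ∘ toℕ) (allFin n)
      ≡⟨ concatMap-allFin {n} (rowFrom (toℕ a)) ⟩
    row p n (toℕ a)
      ∎

isWheelMinusEdge : ℕ → ℕ → ℕ → ℕ → Bool
isWheelMinusEdge k j a b =
  isWheelEdge k a b ∧
  (if sameEdge a b 1 k ∨ sameEdge a b 1 2 ∨ sameEdge a b 0 j then false else true)

leaves : ℕ → ℕ → List ℕ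
leaves k j = filter (_≢? j) (range 1 k)

centre-row : ∀ k j s c →
  concatMap (λ b → if isWheelMinusEdge k j 0 b then [ (0 , b) ] else []) (range (suc s) c)
    ≡ spokes 0 (filter (_≢? j) (range (suc s) c))
centre-row k j s zero    = refl
centre-row k j s (suc c) with suc s ≡ᵇ j
... | true  = centre-row k j (suc s) c
... | false = cong ((0 , suc s) ∷_) (centre-row k j (suc s) c)

isWheelMinusEdge-from-1 : ∀ k j b → isWheelMinusEdge k j 1 b ≡ false
isWheelMinusEdge-from-1 k j b with 1 <ᵇ b | b ≡ᵇ 2 | b ≡ᵇ k
... | false | _     | _     = refl
... | true  | true  | true  = refl
... | true  | true  | false = refl
... | true  | false | true  = refl
... | true  | false | false = refl

<ᵇ-suc : ∀ n → (n <ᵇ suc n) ≡ true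
<ᵇ-suc zero    = refl
<ᵇ-suc (suc n) = <ᵇ-suc n

isWheelMinusEdge-path : ∀ k j a b → isWheelMinusEdge k j (2 + a) b ≡ (b ≡ᵇ 3 + a)
isWheelMinusEdge-path k j a b with b ≡ᵇ 3 + a in b≡3+a
... | false with 2 + a <ᵇ b
...   | true  = refl
...   | false = refl
isWheelMinusEdge-path k j a b | true
  rewrite ≡ᵇ⇒≡ b (3 + a) (subst T (sym b≡3+a) _) | <ᵇ-suc a = refl

target-row : ℕ → ℕ → List ℕ → List (ℕ × ℕ)
target-row a t = concatMap (λ b → if b ≡ᵇ t then [ (a , b) ] else [])

target-row-∉ : ∀ a {t} xs → t ∉ xs → target-row a t xs ≡ []
target-row-∉ a []       _    = refl
target-row-∉ a (x ∷ xs) t∉xs rewrite ≢⇒≡ᵇ-false (λ x≡t → t∉xs (here (sym x≡t))) =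
  target-row-∉ a xs (t∉xs ∘ there)

target-row-range : ∀ a {t} s c → t ∈ range s c → target-row a t (range s c) ≡ [ (a , t) ]
target-row-range a s (suc c) (here refl) rewrite ≡ᵇ-refl s =
  cong ((a , s) ∷_) (target-row-∉ a (range (suc s) c) (∉-range-below c (n<1+n s)))
target-row-range a s (suc c) (there t∈)
  rewrite ≢⇒≡ᵇ-false (λ s≡t → ∉-range-below c (n<1+n s) (subst (_∈ _) (sym s≡t) t∈)) =
  target-row-range a (suc s) c t∈

is-target-row : ∀ k j a →
  row (isWheelMinusEdge k j) (suc k) (2 + a) ≡ target-row (2 + a) (3 + a) (range 0 (suc k))
is-target-row k j a = concatMap-cong (λ b → cong (λ q → if q then [ (2 + a , b) ] else [])
                                                 (isWheelMinusEdge-path k j a b))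
                                     (range 0 (suc k))

concatMap-nil : ∀ {A B : Set} (xs : List A) → concatMap (λ _ → [] {A = B}) xs ≡ []
concatMap-nil []       = refl
concatMap-nil (x ∷ xs) = concatMap-nil xs

path-rows : ∀ k j s c → 2 + s + c ≡ k →
  concatMap (row (isWheelMinusEdge k j) (suc k)) (range (2 + s) (suc c)) ≡ path (2 + s) c
path-rows k j s zero 2+s+0≡k = cong (_++ []) (begin
  row (isWheelMinusEdge k j) (suc k) (2 + s)   ≡⟨ is-target-row k j s ⟩
  target-row (2 + s) (3 + s) (range 0 (suc k)) ≡⟨ target-row-∉ (2 + s) (range 0 (suc k)) 3+s∉ ⟩
  []                                           ∎)
  where
  open ≡-Reasoning
  3+s∉ : 3 + s ∉ range 0 (suc k)
  3+s∉ = ∉-range-above (suc k) (s≤s (≤-reflexive (trans (sym 2+s+0≡k) (+-identityʳ (2 + s)))))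
path-rows k j s (suc c) 2+s+c≡k = cong₂ _++_ (begin
  row (isWheelMinusEdge k j) (suc k) (2 + s)   ≡⟨ is-target-row k j s ⟩
  target-row (2 + s) (3 + s) (range 0 (suc k)) ≡⟨ target-row-range (2 + s) 0 (suc k) 3+s∈ ⟩
  [ (2 + s , 3 + s) ]                          ∎)
  (path-rows k j (suc s) c (trans (sym (+-suc (2 + s) c)) 2+s+c≡k))
  where
  open ≡-Reasoning
  3+s∈ : 3 + s ∈ range 0 (suc k)
  3+s∈ = ∈-range⁺ 0 (suc k) z≤n
           (s≤s (subst (3 + s ≤_) (trans (sym (+-suc (2 + s) c)) 2+s+c≡k) (s≤s (m≤m+n (2 + s) c))))

wheelMinus-edges : ∀ c j → toℕ-edges (wheelMinus (2 + c) j) ≡ spokes 0 (leaves (2 + c) j) ++ path 2 c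
wheelMinus-edges c j = begin
  toℕ-edges (wheelMinus (2 + c) j)
    ≡⟨ toℕ-pairsWhere p ⟩
  row p (3 + c) 0 ++ row p (3 + c) 1 ++ concatMap (row p (3 + c)) (range 2 (suc c))
    ≡⟨ cong₂ _++_ (centre-row (2 + c) j 0 (2 + c)) (cong₂ _++_ no-row-from-1 (path-rows (2 + c) j 0 c refl)) ⟩
  spokes 0 (leaves (2 + c) j) ++ path 2 c
    ∎
  where
  open ≡-Reasoning
  p : ℕ → ℕ → Bool
  p = isWheelMinusEdge (2 + c) j
  no-row-from-1 : row p (3 + c) 1 ≡ []
  no-row-from-1 = trans (concatMap-cong (λ b → cong (λ q → if q then [ (1 , b) ] else [])
                                                     (isWheelMinusEdge-from-1 (2 + c) j b))
                                        (range 0 (3 + c)))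
                        (concatMap-nil (range 0 (3 + c)))

coeffℕ-wheelMinus : ∀ n c j {bs} → leaves (2 + c) j ↭ bs →
  coeffℕ n (toℕ-edges (wheelMinus (2 + c) j)) ≗ coeffℕ n (spokes 0 bs ++ path 2 c)
coeffℕ-wheelMinus n c j leaves↭bs μ =
  trans (cong (λ es → coeffℕ n es μ) (wheelMinus-edges c j))
        (coeffℕ-↭ n (spokes-↭ 0 (path 2 c) leaves↭bs) μ)

-- The monomial v³ ∏_{3 ≤ i < k} v_i², for 3 ≤ j < k

hubCubeMonomial : ℕ → List ℕ
hubCubeMonomial k = 0 ∷ 0 ∷ 0 ∷ range 3 (k ∸ 3) ++ range 3 (k ∸ 3)

∉-hubCubeMonomial : ∀ x {f} → 0 < f → f < 3 ⊎ 3 + x ≤ f → f ∉ hubCubeMonomial (3 + x)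
∉-hubCubeMonomial x {f} 0<f outside =
  ∉-∷ f≢0 (∉-∷ f≢0 (∉-∷ f≢0 (∉-++ (∉-range x outside) (∉-range x outside))))
  where
  f≢0 : f ≢ 0
  f≢0 = <⇒≢ 0<f ∘ sym

leaves-hubCube-↭ : ∀ a b →
  leaves (3 + (a + suc b)) (3 + a) ↭ (3 + (a + suc b)) ∷ 1 ∷ 2 ∷ range 3 a ++ range (4 + a) b
leaves-hubCube-↭ a b = begin
  filter (_≢? 3 + a) (range 1 (3 + (a + suc b)))
    ≡⟨ cong (λ x → filter (_≢? 3 + a) (range 1 (2 + x))) (+-suc a (suc b)) ⟨
  filter (_≢? 3 + a) (range 1 (2 + a + suc (suc b)))
    ≡⟨ filter-range-hole 1 (2 + a) (suc b) ⟩
  (1 ∷ 2 ∷ range 3 a) ++ range (4 + a) (suc b)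
    ↭⟨ range-last-to-front (1 ∷ 2 ∷ range 3 a) (4 + a) b ⟩
  (4 + a + b) ∷ 1 ∷ 2 ∷ range 3 a ++ range (4 + a) b
    ≡⟨ cong (λ x → (3 + x) ∷ 1 ∷ 2 ∷ range 3 a ++ range (4 + a) b) (+-suc a b) ⟨
  (3 + (a + suc b)) ∷ 1 ∷ 2 ∷ range 3 a ++ range (4 + a) b
    ∎
  where open ↭.PermutationReasoning

coeffℕ-hubCube : ∀ a b →
  coeffℕ (4 + (a + suc b))
         (spokes 0 ((3 + (a + suc b)) ∷ 1 ∷ 2 ∷ range 3 a ++ range (4 + a) b) ++ path 2 (suc (a + suc b)))
         (monomial (hubCubeMonomial (3 + (a + suc b))))
    ≡ -1ℤ ^ (a + b) * -1ℤ ^ suc a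
coeffℕ-hubCube a b = begin
  coeffℕ n (spokes 0 (k ∷ 1 ∷ 2 ∷ M) ++ P) (monomial (hubCubeMonomial k))
    ≡⟨ coeffℕ-spokes-to-centre n 0 (k ∷ 1 ∷ 2 ∷ []) {R ++ R} {spokes 0 M ++ P} exhausted ⟩
  coeffℕ n (spokes 0 M ++ P) (monomial (R ++ R))
    ≡⟨ coeffℕ-monomial-↭ n (spokes 0 M ++ P) split ⟩
  coeffℕ n (spokes 0 M ++ P) (monomial (M ++ (3 + a) ∷ R))
    ≡⟨ coeffℕ-spokes-to-leaves n 0 M 0∉ ⟩
  -1ℤ ^ length M * coeffℕ n P (monomial ((3 + a) ∷ R))
    ≡⟨ cong₂ (λ l x → -1ℤ ^ l * x) length-M (coeffℕ-path-with-extra n 2 a b (n<1+n k)) ⟩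
  -1ℤ ^ (a + b) * -1ℤ ^ suc a
    ∎
  where
  open ≡-Reasoning
  k n : ℕ
  k = 3 + (a + suc b)
  n = suc k
  R M : List ℕ
  R = range 3 (a + suc b)
  M = range 3 a ++ range (4 + a) b
  P : List (ℕ × ℕ)
  P = path 2 (suc (a + suc b))
  exhausted : All (_∉ hubCubeMonomial k) (k ∷ 1 ∷ 2 ∷ [])
  exhausted = ∉-hubCubeMonomial (a + suc b) (s≤s z≤n) (inj₂ ≤-refl)
            ∷ ∉-hubCubeMonomial (a + suc b) (s≤s z≤n) (inj₁ (s≤s (s≤s z≤n)))
            ∷ ∉-hubCubeMonomial (a + suc b) (s≤s z≤n) (inj₁ (s≤s (s≤s (s≤s z≤n))))
            ∷ []
  split : R ++ R ↭ M ++ (3 + a) ∷ R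
  split = ↭.trans (++⁺ʳ R (range-hole-↭ 3 a b)) (↭.↭-sym (shift (3 + a) M R))
  0∉ : 0 ∉ M ++ (3 + a) ∷ R
  0∉ = ∉-++ (∉-++ (∉-range-below a (s≤s z≤n)) (∉-range-below b (s≤s z≤n)))
            (∉-∷ (λ ()) (∉-range-below (a + suc b) (s≤s z≤n)))
  length-M : length M ≡ a + b
  length-M = trans (length-++ (range 3 a)) (cong₂ _+_ (length-range 3 a) (length-range (4 + a) b))

-- The monomial v⁴ v₃ ∏_{4 ≤ i < k} v_i², for j ∈ {1, 2, k}

hubFourthMonomial : ℕ → List ℕ
hubFourthMonomial k = 0 ∷ 0 ∷ 0 ∷ 0 ∷ 3 ∷ range 4 (k ∸ 4) ++ range 4 (k ∸ 4)

∉-hubFourthMonomial : ∀ c {f} → 0 < f → f < 3 ⊎ 4 + c ≤ f → f ∉ hubFourthMonomial (4 + c)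
∉-hubFourthMonomial c {f} 0<f outside =
  ∉-∷ f≢0 (∉-∷ f≢0 (∉-∷ f≢0 (∉-∷ f≢0 (∉-++ f∉3⋯ (f∉3⋯ ∘ there)))))
  where
  f≢0 : f ≢ 0
  f≢0 = <⇒≢ 0<f ∘ sym
  f∉3⋯ : f ∉ range 3 (suc c)
  f∉3⋯ = ∉-range (suc c) outside

leaves-hubFourth-↭ : ∀ c j → j ≡ 1 ⊎ j ≡ 2 ⊎ j ≡ 4 + c →
  Σ[ f₁ ∈ ℕ ] Σ[ f₂ ∈ ℕ ] (leaves (4 + c) j ↭ f₁ ∷ f₂ ∷ 3 ∷ range 4 c)
                         × All (_∉ hubFourthMonomial (4 + c)) (f₁ ∷ f₂ ∷ [])
leaves-hubFourth-↭ c j (inj₁ refl) =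
  4 + c , 2 ,
  ↭.trans (↭.↭-reflexive (filter-range-hole 1 0 (3 + c))) (range-last-to-front (2 ∷ 3 ∷ []) 4 c) ,
  ∉-hubFourthMonomial c (s≤s z≤n) (inj₂ ≤-refl)
    ∷ ∉-hubFourthMonomial c (s≤s z≤n) (inj₁ ≤-refl) ∷ []
leaves-hubFourth-↭ c j (inj₂ (inj₁ refl)) =
  4 + c , 1 ,
  ↭.trans (↭.↭-reflexive (filter-range-hole 1 1 (2 + c))) (range-last-to-front (1 ∷ 3 ∷ []) 4 c) ,
  ∉-hubFourthMonomial c (s≤s z≤n) (inj₂ ≤-refl)
    ∷ ∉-hubFourthMonomial c (s≤s z≤n) (inj₁ (s≤s (s≤s z≤n))) ∷ []
leaves-hubFourth-↭ c j (inj₂ (inj₂ refl)) =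
  1 , 2 ,
  ↭.↭-reflexive (filter-range-last 1 (3 + c)) ,
  ∉-hubFourthMonomial c (s≤s z≤n) (inj₁ (s≤s (s≤s z≤n)))
    ∷ ∉-hubFourthMonomial c (s≤s z≤n) (inj₁ ≤-refl) ∷ []

hubFourth-sink-term : ∀ a b →
  coeffℕ (5 + (a + suc b)) (path 2 (2 + (a + suc b))) (monomial ((4 + a) ∷ range 3 (suc (a + suc b))))
    ≡ -1ℤ ^ (4 + a)
hubFourth-sink-term a b =
  trans (coeffℕ-path-with-extra (5 + (a + suc b)) 2 (suc a) b (n<1+n (4 + (a + suc b))))
        (sym (negate-twice (-1ℤ ^ (2 + a))))

coeffℕ-hubFourth : ∀ c f₁ f₂ → All (_∉ hubFourthMonomial (4 + c)) (f₁ ∷ f₂ ∷ []) →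
  coeffℕ (5 + c) (spokes 0 (f₁ ∷ f₂ ∷ 3 ∷ range 4 c) ++ path 2 (2 + c))
         (monomial (hubFourthMonomial (4 + c)))
    ≡ -1ℤ ^ suc c * (∑[ m ∈ range 4 c ] (-1ℤ ^ m))
coeffℕ-hubFourth c f₁ f₂ exhausted = begin
  coeffℕ n (spokes 0 (f₁ ∷ f₂ ∷ 3 ∷ R) ++ P) (monomial (hubFourthMonomial (4 + c)))
    ≡⟨ coeffℕ-spokes-to-centre n 0 (f₁ ∷ f₂ ∷ []) {0 ∷ 0 ∷ 3 ∷ R ++ R} {spokes 0 (3 ∷ R) ++ P}
                               exhausted ⟩
  coeffℕ n ((0 , 3) ∷ spokes 0 R ++ P) (monomial (0 ∷ 0 ∷ 3 ∷ R ++ R))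
    ≡⟨ cong₂ _-_ charge-hub charge-3 ⟩
  C (monomial (0 ∷ R ++ range 3 (suc c))) - 0ℤ
    ≡⟨ ℤ.+-identityʳ _ ⟩
  C (monomial (0 ∷ R ++ range 3 (suc c)))
    ≡⟨ coeffℕ-spokes-one-to-centre n 0 R (s≤s z≤n) 0∉ (path-isolated (2 + c) (s≤s z≤n)) ⟩
  -1ℤ ^ suc (length R) * (∑[ m ∈ R ] coeffℕ n P (monomial (m ∷ range 3 (suc c))))
    ≡⟨ cong₂ (λ l s → -1ℤ ^ suc l * s) (length-range 4 c) (∑-cong-∈ R sink-term) ⟩
  -1ℤ ^ suc c * (∑[ m ∈ R ] (-1ℤ ^ m))
    ∎
  where
  open ≡-Reasoning
  n : ℕ
  n = 5 + c
  R : List ℕ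
  R = range 4 c
  P : List (ℕ × ℕ)
  P = path 2 (2 + c)
  C : Exponents → ℤ
  C = coeffℕ n (spokes 0 R ++ P)
  C-congruent : Congruent C
  C-congruent = coeffℕ-congruent n (spokes 0 R ++ P)
  0∉ : 0 ∉ R ++ range 3 (suc c)
  0∉ = ∉-++ (∉-range-below c (s≤s z≤n)) (∉-range-below (suc c) (s≤s z≤n))
  absent : ∀ {i} → 0 < i → i < 4 → i ∉ 0 ∷ 0 ∷ R ++ R
  absent 0<i i<4 =
    ∉-∷ (<⇒≢ 0<i ∘ sym) (∉-∷ (<⇒≢ 0<i ∘ sym) (∉-++ (∉-range-below c i<4) (∉-range-below c i<4)))
  charge-hub : divide 0 C (monomial (0 ∷ 0 ∷ 3 ∷ R ++ R)) ≡ C (monomial (0 ∷ R ++ range 3 (suc c)))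
  charge-hub = trans (divide-here C-congruent 0 (0 ∷ 3 ∷ R ++ R))
                     (coeffℕ-monomial-↭ n (spokes 0 R ++ P) (↭.prep 0 (↭.↭-sym (shift 3 R R))))
  -- Charged to v₃, the spoke exhausts v₃, and then the edge v₂v₃ has both ends exhausted.
  charge-3 : divide 3 C (monomial (0 ∷ 0 ∷ 3 ∷ R ++ R)) ≡ 0ℤ
  charge-3 = begin
    divide 3 C (monomial (0 ∷ 0 ∷ 3 ∷ R ++ R))
      ≡⟨ divide-congruent {3} {C} C-congruent (monomial-↭ (shift 3 (0 ∷ 0 ∷ []) (R ++ R))) ⟩
    divide 3 C (monomial (3 ∷ 0 ∷ 0 ∷ R ++ R))
      ≡⟨ divide-here C-congruent 3 (0 ∷ 0 ∷ R ++ R) ⟩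
    C (monomial (0 ∷ 0 ∷ R ++ R))
      ≡⟨ coeffℕ-zero-edge n {2} {3} (∈-++⁺ʳ (spokes 0 R) (here refl))
           (monomial-∉ (absent (s≤s z≤n) (s≤s (s≤s (s≤s z≤n)))))
           (monomial-∉ (absent (s≤s z≤n) ≤-refl)) ⟩
    0ℤ
      ∎
  sink-term : ∀ {m} → m ∈ R → coeffℕ n P (monomial (m ∷ range 3 (suc c))) ≡ -1ℤ ^ m
  sink-term m∈ with ∈-range⁻ 4 c m∈
  ... | a , b , refl , c≡a+b+1 =
    subst (λ c → coeffℕ (5 + c) (path 2 (2 + c)) (monomial ((4 + a) ∷ range 3 (suc c))) ≡ -1ℤ ^ (4 + a))
          (sym c≡a+b+1) (hubFourth-sink-term a b)

Admissible : ℕ → List ℕ → Set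
Admissible k ms = ∀ i →
  ((i ≡ 1 ⊎ i ≡ 2 ⊎ i ≡ k) → monomial ms i ≡ 0) ×
  (i ≡ 0 → monomial ms i ≤ 4) ×
  ((3 ≤ i × i ≤ k ∸ 1) → monomial ms i ≤ 2)

hubCube-admissible : ∀ x → Admissible (3 + x) (hubCubeMonomial (3 + x))
hubCube-admissible x zero =
  (λ { (inj₁ ()) ; (inj₂ (inj₁ ())) ; (inj₂ (inj₂ ())) }) ,
  (λ _ → ≤-trans (≤-reflexive (cong (3 +_) (monomial-∉ 0∉))) (n≤1+n 3)) ,
  (λ { (() , _) })
  where
  0∉ : 0 ∉ range 3 x ++ range 3 x
  0∉ = ∉-++ (∉-range-below x (s≤s z≤n)) (∉-range-below x (s≤s z≤n))
hubCube-admissible x (suc i) = vanish , (λ ()) , (λ _ → monomial-two-ranges-≤2 3 x 3 x (suc i))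
  where
  vanish : (suc i ≡ 1 ⊎ suc i ≡ 2 ⊎ suc i ≡ 3 + x) → monomial (hubCubeMonomial (3 + x)) (suc i) ≡ 0
  vanish (inj₁ refl)        = monomial-∉ (∉-hubCubeMonomial x (s≤s z≤n) (inj₁ (s≤s (s≤s z≤n))))
  vanish (inj₂ (inj₁ refl)) = monomial-∉ (∉-hubCubeMonomial x (s≤s z≤n) (inj₁ ≤-refl))
  vanish (inj₂ (inj₂ refl)) = monomial-∉ (∉-hubCubeMonomial x (s≤s z≤n) (inj₂ ≤-refl))

hubFourth-admissible : ∀ c → Admissible (4 + c) (hubFourthMonomial (4 + c))
hubFourth-admissible c zero =
  (λ { (inj₁ ()) ; (inj₂ (inj₁ ())) ; (inj₂ (inj₂ ())) }) ,
  (λ _ → ≤-reflexive (cong (4 +_) (monomial-∉ 0∉))) ,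
  (λ { (() , _) })
  where
  0∉ : 0 ∉ range 4 c ++ range 4 c
  0∉ = ∉-++ (∉-range-below c (s≤s z≤n)) (∉-range-below c (s≤s z≤n))
hubFourth-admissible c (suc i) = vanish , (λ ()) , (λ _ → monomial-two-ranges-≤2 3 (suc c) 4 c (suc i))
  where
  vanish : (suc i ≡ 1 ⊎ suc i ≡ 2 ⊎ suc i ≡ 4 + c) → monomial (hubFourthMonomial (4 + c)) (suc i) ≡ 0
  vanish (inj₁ refl)        = monomial-∉ (∉-hubFourthMonomial c (s≤s z≤n) (inj₁ (s≤s (s≤s z≤n))))
  vanish (inj₂ (inj₁ refl)) = monomial-∉ (∉-hubFourthMonomial c (s≤s z≤n) (inj₁ ≤-refl))
  vanish (inj₂ (inj₂ refl)) = monomial-∉ (∉-hubFourthMonomial c (s≤s z≤n) (inj₂ ≤-refl))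

Witness : ℕ → ℕ → Set
Witness k j =
  Σ[ ms ∈ List ℕ ] Admissible k ms × coeffℕ (suc k) (toℕ-edges (wheelMinus k j)) (monomial ms) ≢ 0ℤ

hubCube-witness : ∀ a b → Witness (3 + (a + suc b)) (3 + a)
hubCube-witness a b =
  hubCubeMonomial k , hubCube-admissible (a + suc b) , -1^≢0 (a + b + suc a) ∘ trans (sym coeff≡)
  where
  open ≡-Reasoning
  k : ℕ
  k = 3 + (a + suc b)
  μ : Exponents
  μ = monomial (hubCubeMonomial k)
  coeff≡ : coeffℕ (suc k) (toℕ-edges (wheelMinus k (3 + a))) μ ≡ -1ℤ ^ (a + b + suc a)
  coeff≡ = begin
    coeffℕ (suc k) (toℕ-edges (wheelMinus k (3 + a))) μ
      ≡⟨ coeffℕ-wheelMinus (suc k) (suc (a + suc b)) (3 + a) (leaves-hubCube-↭ a b) μ ⟩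
    coeffℕ (suc k) (spokes 0 (k ∷ 1 ∷ 2 ∷ range 3 a ++ range (4 + a) b) ++ path 2 (suc (a + suc b))) μ
      ≡⟨ coeffℕ-hubCube a b ⟩
    -1ℤ ^ (a + b) * -1ℤ ^ suc a
      ≡⟨ ℤ.^-distribˡ-+-* -1ℤ (a + b) (suc a) ⟨
    -1ℤ ^ (a + b + suc a)
      ∎

hubFourth-witness : ∀ c j → ¬ 2 ∣ (4 + c) → j ≡ 1 ⊎ j ≡ 2 ⊎ j ≡ 4 + c → Witness (4 + c) j
hubFourth-witness c j k-odd j∈
  with odd⇒suc-double c (k-odd ∘ ∣m∣n⇒∣m+n (∣m∣n⇒∣m+n ∣-refl ∣-refl)) | leaves-hubFourth-↭ c j j∈
... | t , refl | f₁ , f₂ , leaves↭ , exhausted =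
  hubFourthMonomial (4 + c) , hubFourth-admissible c , (λ ()) ∘ trans (sym coeff≡1)
  where
  open ≡-Reasoning
  μ : Exponents
  μ = monomial (hubFourthMonomial (4 + c))
  coeff≡1 : coeffℕ (5 + c) (toℕ-edges (wheelMinus (4 + c) j)) μ ≡ 1ℤ
  coeff≡1 = begin
    coeffℕ (5 + c) (toℕ-edges (wheelMinus (4 + c) j)) μ
      ≡⟨ coeffℕ-wheelMinus (5 + c) (2 + c) j leaves↭ μ ⟩
    coeffℕ (5 + c) (spokes 0 (f₁ ∷ f₂ ∷ 3 ∷ range 4 c) ++ path 2 (2 + c)) μ
      ≡⟨ coeffℕ-hubFourth c f₁ f₂ exhausted ⟩
    -1ℤ ^ (2 + (t + t)) * (∑[ m ∈ range 4 c ] (-1ℤ ^ m))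
      ≡⟨ cong (-1ℤ ^ (2 + (t + t)) *_) (∑-alternating 4 t) ⟩
    -1ℤ ^ (2 + (t + t)) * 1ℤ
      ≡⟨ ℤ.*-identityʳ _ ⟩
    -1ℤ ^ (2 + (t + t))
      ≡⟨ negate-twice (-1ℤ ^ (t + t)) ⟩
    -1ℤ ^ (t + t)
      ≡⟨ -1^-even t ⟩
    1ℤ
      ∎

wheelMinus-witness : ∀ k j → 3 < k → ¬ 2 ∣ k → 1 ≤ j → j ≤ k → Witness k j
wheelMinus-witness (suc (suc (suc (suc c)))) j (s≤s (s≤s (s≤s (s≤s _)))) k-odd = witness j
  where
  witness : ∀ j → 1 ≤ j → j ≤ 4 + c → Witness (4 + c) j
  witness 1 _ _ = hubFourth-witness c 1 k-odd (inj₁ refl)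
  witness 2 _ _ = hubFourth-witness c 2 k-odd (inj₂ (inj₁ refl))
  witness (suc (suc (suc a))) _ j≤k with 3 + a ≟ 4 + c
  ... | yes j≡k = hubFourth-witness c (3 + a) k-odd (inj₂ (inj₂ j≡k))
  ... | no j≢k with m≤n⇒∃[o]m+o≡n (≤∧≢⇒< j≤k j≢k)
  ...   | b , 4+a+b≡k =
    subst (λ k → Witness k (3 + a)) (trans (cong (3 +_) (+-suc a b)) 4+a+b≡k) (hubCube-witness a b)

lemma5p13 : (k : ℕ) → 3 < k → ¬ (2 ∣ k) →
    (j : Fin (suc k)) → 1 ≤ toℕ j →
    Σ (Monomial (suc k)) (λ α →
      ((i : Fin (suc k)) →
        ((toℕ i ≡ 1 ⊎ toℕ i ≡ 2 ⊎ toℕ i ≡ k) → α i ≡ 0) ×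
        (toℕ i ≡ 0 → α i ≤ 4) ×
        ((3 ≤ toℕ i × toℕ i ≤ k ∸ 1) → α i ≤ 2)) ×
      coeff (wheelMinus k (toℕ j)) α ≢ 0ℤ)
lemma5p13 k 3<k k-odd j 1≤j with wheelMinus-witness k (toℕ j) 3<k k-odd 1≤j (≤-pred (toℕ<n j))
... | ms , admissible , coeff≢0 =
  (λ i → monomial ms (toℕ i)) ,
  (λ i → admissible (toℕ i)) ,
  coeff≢0 ∘ trans (sym (coeff-toℕ (wheelMinus k (toℕ j)) _ (monomial ms) (λ _ → refl)))
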